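{- Let $\Gamma$ be an AGW graph with a coloring such that the resulting automaton has no stable pair of states. Let $A$ and $B$ be distinct $F$-cliques of this automaton with $|A|>1$. Then $|A|-|A\cap B|=|B|-|A\cap B|>1$.
   Context: An AGW graph is a finite directed strongly connected graph (multiple edges allowed) in which all vertices have the same outdegree $k$, and the greatest common divisor of the lengths of all its cycles is $1$. A coloring assigns to the edges letters from an alphabet $\Sigma$ with $|\Sigma|=k$ so that the outgoing edges of each vertex receive distinct letters, giving a deterministic complete automaton on the vertex set. For a state $\mathbf p$ and $s\in\Sigma^+$, $\mathbf p s$ is the end of the path from $\mathbf p$ labeled $s$; for a set $P$, $Ps=\{\mathbf p s:\mathbf p\in P\}$, and $\Gamma s$ is the image of the whole state set. A pair of distinct states $\mathbf p,\mathbf q$ is synchronizing if $\mathbf p s=\mathbf q s$ for some $s\in\Sigma^+$, and a deadlock otherwise. A synchronizing pair $\mathbf p,\mathbf q$ is stable if for every word $u$ the pair $\mathbf p u,\mathbf q u$ is also synchronizing (i.e. $\mathbf pu=\mathbf qu$ or they form a synchronizing pair). An $F$-clique is a set of the form $\Gamma s$ for some $s\in\Sigma^+$ such that every pair of distinct states in it is a deadlock. -}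

module Defs where

open import Data.Nat using (ℕ; zero; suc; _∸_; _<_)
open import Data.Nat.Divisibility using (_∣_)
open import Data.Fin using (Fin)
open import Data.Fin.Properties using (any?; _≟_)
open import Data.Fin.Subset using (Subset; _∈_; _∩_; ∣_∣)
open import Data.Vec using (tabulate)
open import Data.List using (List; []; _∷_; length)
open import Data.List.NonEmpty using (List⁺; toList)
open import Data.Product using (Σ; ∃; _×_; _,_)
open import Data.Sum using (_⊎_)
open import Relation.Nullary using (¬_)
open import Relation.Nullary.Decidable using (⌊_⌋)
open import Relation.Binary.PropositionalEquality using (_≡_; _≢_)

-- A deterministic complete automaton (= a coloured graph of uniform outdegree k)
-- with state set Fin n and alphabet Fin k, given by its transition function δ.
-- The edges of the underlying graph are the triples (p , a , δ p a).

module _ {n k : ℕ} (δ : Fin n → Fin k → Fin n) where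

  run : Fin n → List (Fin k) → Fin n
  run p []       = p
  run p (a ∷ w)  = run (δ p a) w

  runs : Fin n → List⁺ (Fin k) → Fin n
  runs p s = run p (toList s)

  StronglyConnected : Set
  StronglyConnected = ∀ (p q : Fin n) → ∃ λ (w : List (Fin k)) → run p w ≡ q

  -- gcd of the lengths of all cycles is 1: the only common divisor of all
  -- lengths of (closed) cycles is 1. Cycles = closed paths of positive length.
  Aperiodic : Set
  Aperiodic = ∀ (d : ℕ) →
    (∀ (p : Fin n) (s : List⁺ (Fin k)) → runs p s ≡ p → d ∣ length (toList s)) →
    d ≡ 1

  AGW : Set
  AGW = StronglyConnected × Aperiodic

  SynchronizingPair : Fin n → Fin n → Set
  SynchronizingPair p q = p ≢ q × ∃ λ (s : List⁺ (Fin k)) → runs p s ≡ runs q s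

  Deadlock : Fin n → Fin n → Set
  Deadlock p q = p ≢ q × ¬ SynchronizingPair p q

  StablePair : Fin n → Fin n → Set
  StablePair p q = SynchronizingPair p q ×
    (∀ (u : List (Fin k)) → run p u ≡ run q u ⊎ SynchronizingPair (run p u) (run q u))

  NoStablePair : Set
  NoStablePair = ∀ (p q : Fin n) → ¬ StablePair p q

  image : List⁺ (Fin k) → Subset n
  image s = tabulate (λ q → ⌊ any? (λ p → runs p s ≟ q) ⌋)

  FClique : Subset n → Set
  FClique A = (∃ λ (s : List⁺ (Fin k)) → A ≡ image s) ×
    (∀ (p q : Fin n) → p ∈ A → q ∈ A → p ≢ q → Deadlock p q)

module Submission where

-- Let A = Γs and B = Γt be distinct F-cliques.  Every pair of
-- distinct states of an F-clique is a deadlock, so a deadlock pair is never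
-- merged, not even after a common prefix u: the maps z ↦ (z·u)·s are
-- injective on A and on B.  Hence
--   (1) |A| ≤ |Γt| = |B| and symmetrically, so |A| = |B|  (pigeonhole);
--   (2) A ∖ B and B ∖ A are nonempty, since A ≠ B have the same size;
--   (3) if A ∖ B = {x} and B ∖ A = {y}, then for every word u the map
--       z ↦ (z·u)·s sends A ∪ B (of size |A| + 1) into Γs = A, so it is not
--       injective; a collision can only be between x and y, so s merges x·u
--       and y·u for every u, and x, y is a stable pair — excluded by hypothesis.

open import Defs
open import Data.Nat using (ℕ; suc; _∸_; _<_; _≤_; _+_; s≤s; z≤n)
open import Data.Nat.Properties
  using (≤-antisym; ≤-reflexive; ≤-<-trans; <⇒≱; ∸-monoˡ-≤; m+n∸n≡m; module ≤-Reasoning)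
open import Data.Fin using (Fin; zero; suc)
open import Data.Fin.Properties using (any?; _≟_; suc-injective; 0≢1+n)
open import Data.Fin.Subset using (Subset; inside; outside; _∩_; _∪_; ∣_∣; _∈_; _∉_; _⊆_; _-_)
open import Data.Fin.Subset.Properties
  using (_∈?_; p⊆q⇒∣p∣≤∣q∣; p⊂q⇒∣p∣<∣q∣; x∈p∧x≢y⇒x∈p-y; x∈p⇒∣p-x∣<∣p∣;
         x∈p∩q⁻; x∈p∪q⁺; x∈p∪q⁻; p⊆p∪q; p∩q⊆p; p∩q⊆q; ⊆-antisym)
open import Data.Vec.Base using ([]; _∷_; here; there; lookup)
open import Data.Vec.Properties using (lookup⇒[]=; lookup∘tabulate)
open import Data.List using ([]; _∷_; _++_)
open import Data.List.NonEmpty using (_∷_; toList; _⁺++_)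
open import Data.Product using (_×_; _,_; ∃; proj₁; proj₂)
open import Data.Sum using (_⊎_; inj₁; inj₂)
open import Data.Empty using (⊥-elim)
open import Function using (_∘_)
open import Relation.Nullary using (Dec; yes; no; does)
open import Relation.Nullary.Decidable using (⌊_⌋; _×-dec_; ¬?; isYes≗does; dec-true; decidable-stable)
open import Relation.Binary.PropositionalEquality
  using (_≡_; _≢_; refl; sym; trans; subst; subst₂; cong; module ≡-Reasoning)

InjectiveOn : ∀ {n} {X : Set} → Subset n → (Fin n → X) → Set
InjectiveOn D f = ∀ {a b} → a ∈ D → b ∈ D → f a ≡ f b → a ≡ b

injectiveOn-tail : ∀ {n} {X : Set} {side} {D : Subset n} {f : Fin (suc n) → X} →
  InjectiveOn (side ∷ D) f → InjectiveOn D (f ∘ suc)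
injectiveOn-tail inj a∈ b∈ eq = suc-injective (inj (there a∈) (there b∈) eq)

-- Pigeonhole: a map injective on D with values in A forces |D| ≤ |A|.
-- The first element of D is sent to f 0, so the rest lands in A - f 0.
injective⇒∣∣≤ : ∀ {n m} (D : Subset n) {A : Subset m} {f : Fin n → Fin m} →
  InjectiveOn D f → (∀ {z} → z ∈ D → f z ∈ A) → ∣ D ∣ ≤ ∣ A ∣
injective⇒∣∣≤ [] _ _ = z≤n
injective⇒∣∣≤ (outside ∷ D) inj into = injective⇒∣∣≤ D (injectiveOn-tail inj) (into ∘ there)
injective⇒∣∣≤ (inside ∷ D) {A} {f} inj into =
  ≤-<-trans (injective⇒∣∣≤ D (injectiveOn-tail inj) intoRest) (x∈p⇒∣p-x∣<∣p∣ (into here))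
  where
  intoRest : ∀ {z} → z ∈ D → f (suc z) ∈ A - f zero
  intoRest z∈ = x∈p∧x≢y⇒x∈p-y (into (there z∈)) (λ eq → 0≢1+n (inj here (there z∈) (sym eq)))

⊆-or-witness : ∀ {n} (A B : Subset n) → A ⊆ B ⊎ ∃ λ z → z ∈ A × z ∉ B
⊆-or-witness A B with any? (λ z → (z ∈? A) ×-dec ¬? (z ∈? B))
... | yes witness = inj₂ witness
... | no none = inj₁ λ {z} z∈A → decidable-stable (z ∈? B) (λ z∉B → none (z , z∈A , z∉B))

-- Two distinct subsets with |B| ≤ |A| have an element of A outside B
-- (otherwise A ⊊ B, contradicting the sizes, or A = B).
missing-element : ∀ {n} {A B : Subset n} → ∣ B ∣ ≤ ∣ A ∣ → A ≢ B → ∃ λ z → z ∈ A × z ∉ B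
missing-element {A = A} {B} B≤A A≢B with ⊆-or-witness A B
... | inj₂ witness = witness
... | inj₁ A⊆B with ⊆-or-witness B A
...   | inj₁ B⊆A = ⊥-elim (A≢B (⊆-antisym A⊆B B⊆A))
...   | inj₂ (y , y∈B , y∉A) = ⊥-elim (<⇒≱ (p⊂q⇒∣p∣<∣q∣ (A⊆B , y , y∈B , y∉A)) B≤A)

another-or-only : ∀ {n} (A B : Subset n) (x : Fin n) →
  (∃ λ x' → (x' ∈ A × x' ∉ B) × x' ≢ x) ⊎ (∀ {z} → z ∈ A → z ∉ B → z ≡ x)
another-or-only A B x with any? (λ z → ((z ∈? A) ×-dec ¬? (z ∈? B)) ×-dec ¬? (z ≟ x))
... | yes witness = inj₁ witness
... | no none = inj₂ λ {z} z∈A z∉B → decidable-stable (z ≟ x) (λ z≢x → none (z , (z∈A , z∉B) , z≢x))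

-- Two distinct elements of A missing from C ⊆ A make |A| exceed |C| by at
-- least two, since C ⊆ (A - x) - x'.
two-missing⇒gap : ∀ {n} {A C : Subset n} {x x' : Fin n} → C ⊆ A →
  x ∈ A → x' ∈ A → x ∉ C → x' ∉ C → x' ≢ x → 1 < ∣ A ∣ ∸ ∣ C ∣
two-missing⇒gap {A = A} {C} {x} {x'} C⊆A x∈A x'∈A x∉C x'∉C x'≢x =
  subst (_≤ ∣ A ∣ ∸ ∣ C ∣) (m+n∸n≡m 2 ∣ C ∣) (∸-monoˡ-≤ ∣ C ∣ 2+∣C∣≤∣A∣)
  where
  C⊆A-x-x' : C ⊆ (A - x) - x'
  C⊆A-x-x' z∈C = x∈p∧x≢y⇒x∈p-y (x∈p∧x≢y⇒x∈p-y (C⊆A z∈C) (λ { refl → x∉C z∈C }))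
                               (λ { refl → x'∉C z∈C })
  open ≤-Reasoning
  2+∣C∣≤∣A∣ : 2 + ∣ C ∣ ≤ ∣ A ∣
  2+∣C∣≤∣A∣ = begin-strict
    1 + ∣ C ∣            ≤⟨ s≤s (p⊆q⇒∣p∣≤∣q∣ C⊆A-x-x') ⟩
    1 + ∣ (A - x) - x' ∣  ≤⟨ x∈p⇒∣p-x∣<∣p∣ (x∈p∧x≢y⇒x∈p-y x'∈A x'≢x) ⟩
    ∣ A - x ∣            <⟨ x∈p⇒∣p-x∣<∣p∣ x∈A ⟩
    ∣ A ∣                ∎

∈∪∉⇒∈ : ∀ {n} {A B : Subset n} {z} → z ∈ A ∪ B → z ∉ B → z ∈ A
∈∪∉⇒∈ {A = A} {B} z∈A∪B z∉B with x∈p∪q⁻ A B z∈A∪B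
... | inj₁ z∈A = z∈A
... | inj₂ z∈B = ⊥-elim (z∉B z∈B)

-- A map injective on A and on B, where A ∖ B ⊆ {x} and B ∖ A ⊆ {y}, is
-- injective on A ∪ B unless it identifies x and y: the only pairs of A ∪ B
-- not inside A or inside B are {x, y}.
injectiveOn-∪ : ∀ {n} {X : Set} {A B : Subset n} {f : Fin n → X} {x y : Fin n} →
  InjectiveOn A f → InjectiveOn B f →
  (∀ {z} → z ∈ A → z ∉ B → z ≡ x) → (∀ {z} → z ∈ B → z ∉ A → z ≡ y) →
  f x ≢ f y → InjectiveOn (A ∪ B) f
injectiveOn-∪ {A = A} {B} {f} injA injB onlyX onlyY fx≢fy {a} {b} a∈A∪B b∈A∪B =
  byMembership (a ∈? B) (b ∈? B)
  where
  across : ∀ {c d} → c ∈ A → c ∉ B → d ∈ B → f c ≡ f d → c ≡ d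
  across {c} {d} c∈A c∉B d∈B fc≡fd with d ∈? A
  ... | yes d∈A = injA c∈A d∈A fc≡fd
  ... | no d∉A  = ⊥-elim (fx≢fy (subst₂ (λ p q → f p ≡ f q) (onlyX c∈A c∉B) (onlyY d∈B d∉A) fc≡fd))
  byMembership : Dec (a ∈ B) → Dec (b ∈ B) → f a ≡ f b → a ≡ b
  byMembership (yes a∈B) (yes b∈B) = injB a∈B b∈B
  byMembership (no a∉B)  (no b∉B)  = injA (∈∪∉⇒∈ a∈A∪B a∉B) (∈∪∉⇒∈ b∈A∪B b∉B)
  byMembership (no a∉B)  (yes b∈B) = across (∈∪∉⇒∈ a∈A∪B a∉B) a∉B b∈B
  byMembership (yes a∈B) (no b∉B)  = sym ∘ across (∈∪∉⇒∈ b∈A∪B b∉B) b∉B a∈B ∘ sym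

module _ {n k : ℕ} (δ : Fin n → Fin k → Fin n) where

  run-++ : ∀ p u v → run δ p (u ++ v) ≡ run δ (run δ p u) v
  run-++ p []      v = refl
  run-++ p (a ∷ u) v = run-++ (δ p a) u v

  -- A deadlock pair is never merged, not even after a common prefix u
  -- (otherwise the word u s would synchronize it).
  deadlock-unmerged : ∀ {p q} → Deadlock δ p q →
    ∀ u s → runs δ (run δ p u) s ≢ runs δ (run δ q u) s
  deadlock-unmerged (p≢q , unsync) [] s eq = unsync (p≢q , s , eq)
  deadlock-unmerged {p} {q} (p≢q , unsync) (a ∷ u) s eq =
    unsync (p≢q , (a ∷ u) ⁺++ toList s ,
            trans (run-++ (δ p a) u (toList s)) (trans eq (sym (run-++ (δ q a) u (toList s)))))

  DeadlockSet : Subset n → Set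
  DeadlockSet D = ∀ p q → p ∈ D → q ∈ D → p ≢ q → Deadlock δ p q

  deadlockSet-injective : ∀ {D} → DeadlockSet D → ∀ u s →
    InjectiveOn D (λ z → runs δ (run δ z u) s)
  deadlockSet-injective dead u s {a} {b} a∈D b∈D eq =
    decidable-stable (a ≟ b) (λ a≢b → deadlock-unmerged (dead a b a∈D b∈D a≢b) u s eq)

  runs∈image : ∀ p s → runs δ p s ∈ image δ s
  runs∈image p s = lookup⇒[]= (runs δ p s) (image δ s) (begin
    lookup (image δ s) (runs δ p s)  ≡⟨ lookup∘tabulate _ (runs δ p s) ⟩
    ⌊ found? ⌋                        ≡⟨ isYes≗does found? ⟩
    does found?                      ≡⟨ dec-true found? (p , refl) ⟩
    inside                           ∎)
    where
    open ≡-Reasoning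
    found? : Dec (∃ λ p' → runs δ p' s ≡ runs δ p s)
    found? = any? (λ p' → runs δ p' s ≟ runs δ p s)

  -- An F-clique is no larger than any other, since t is injective on A.
  fclique-∣∣≤ : ∀ {A B} → FClique δ A → FClique δ B → ∣ A ∣ ≤ ∣ B ∣
  fclique-∣∣≤ {A} (_ , deadA) ((t , refl) , _) =
    injective⇒∣∣≤ A (deadlockSet-injective deadA [] t) (λ {z} _ → runs∈image z t)

  merged-everywhere⇒stable : ∀ {p q} s → p ≢ q →
    (∀ u → runs δ (run δ p u) s ≡ runs δ (run δ q u) s) → StablePair δ p q
  merged-everywhere⇒stable {p} {q} s p≢q merged = (p≢q , s , merged []) , afterwards
    where
    afterwards : ∀ u → run δ p u ≡ run δ q u ⊎ SynchronizingPair δ (run δ p u) (run δ q u)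
    afterwards u with run δ p u ≟ run δ q u
    ... | yes same   = inj₁ same
    ... | no differ = inj₂ (differ , s , merged u)

  -- For every u, z ↦ (z·u)·s maps A ∪ B into A with |A| < |A ∪ B|, hence is
  -- not injective there, hence merges x and y; so x, y is a stable pair.
  single-exchange⇒stable : ∀ {A B x y} → FClique δ A → FClique δ B →
    x ∈ A → y ∈ B → y ∉ A →
    (∀ {z} → z ∈ A → z ∉ B → z ≡ x) → (∀ {z} → z ∈ B → z ∉ A → z ≡ y) →
    StablePair δ x y
  single-exchange⇒stable {B = B} {x} {y} ((s , refl) , deadA) (_ , deadB) x∈A y∈B y∉A onlyX onlyY =
    merged-everywhere⇒stable s (λ { refl → y∉A x∈A }) merged
    where
    A : Subset n
    A = image δ s
    merged : ∀ u → runs δ (run δ x u) s ≡ runs δ (run δ y u) s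
    merged u with runs δ (run δ x u) s ≟ runs δ (run δ y u) s
    ... | yes same = same
    ... | no apart =
      ⊥-elim (<⇒≱ ∣A∣<∣A∪B∣ (injective⇒∣∣≤ (A ∪ B) injective (λ {z} _ → runs∈image (run δ z u) s)))
      where
      injective : InjectiveOn (A ∪ B) (λ z → runs δ (run δ z u) s)
      injective = injectiveOn-∪ (deadlockSet-injective deadA u s) (deadlockSet-injective deadB u s)
                                onlyX onlyY apart
      ∣A∣<∣A∪B∣ : ∣ A ∣ < ∣ A ∪ B ∣
      ∣A∣<∣A∪B∣ = p⊂q⇒∣p∣<∣q∣ (p⊆p∪q B , y , x∈p∪q⁺ (inj₂ y∈B) , y∉A)

lemma3 : ∀ {n k : ℕ} (δ : Fin n → Fin k → Fin n) → AGW δ → NoStablePair δ →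
    ∀ (A B : Subset n) → FClique δ A → FClique δ B → A ≢ B → 1 < ∣ A ∣ →
    (∣ A ∣ ∸ ∣ A ∩ B ∣ ≡ ∣ B ∣ ∸ ∣ A ∩ B ∣) × (1 < ∣ A ∣ ∸ ∣ A ∩ B ∣)
lemma3 δ _ noStable A B cliqueA cliqueB A≢B _ = cong (_∸ ∣ A ∩ B ∣) ∣A∣≡∣B∣ , gap
  where
  ∣A∣≡∣B∣ : ∣ A ∣ ≡ ∣ B ∣
  ∣A∣≡∣B∣ = ≤-antisym (fclique-∣∣≤ δ cliqueA cliqueB) (fclique-∣∣≤ δ cliqueB cliqueA)
  ∉∩ʳ : ∀ {z} → z ∉ B → z ∉ A ∩ B
  ∉∩ʳ z∉B = z∉B ∘ proj₂ ∘ x∈p∩q⁻ A B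
  ∉∩ˡ : ∀ {z} → z ∉ A → z ∉ A ∩ B
  ∉∩ˡ z∉A = z∉A ∘ proj₁ ∘ x∈p∩q⁻ A B
  gap : 1 < ∣ A ∣ ∸ ∣ A ∩ B ∣
  gap with missing-element (≤-reflexive (sym ∣A∣≡∣B∣)) A≢B
         | missing-element (≤-reflexive ∣A∣≡∣B∣) (A≢B ∘ sym)
  ... | x , x∈A , x∉B | y , y∈B , y∉A with another-or-only A B x | another-or-only B A y
  ...   | inj₁ (x' , (x'∈A , x'∉B) , x'≢x) | _ =
          two-missing⇒gap (p∩q⊆p A B) x∈A x'∈A (∉∩ʳ x∉B) (∉∩ʳ x'∉B) x'≢x
  ...   | _ | inj₁ (y' , (y'∈B , y'∉A) , y'≢y) =
          subst (λ m → 1 < m ∸ ∣ A ∩ B ∣) (sym ∣A∣≡∣B∣)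
                (two-missing⇒gap (p∩q⊆q A B) y∈B y'∈B (∉∩ˡ y∉A) (∉∩ˡ y'∉A) y'≢y)
  ...   | inj₂ onlyX | inj₂ onlyY =
          ⊥-elim (noStable x y (single-exchange⇒stable δ cliqueA cliqueB x∈A y∈B y∉A onlyX onlyY))
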